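{- Let $\mathcal{X}=\{x_0,\dots,x_n\}$, let $\varphi$ be a hypertrace formula over $\mathcal{X}$, let $T\subseteq(2^{\mathcal{X}})^\omega$ be a set of traces, and let $\Pi_{\mathbb{T}}$ and $\Pi_{\mathbb{N}}$ be a trace assignment and a time assignment defined on the free variables of $\varphi$. Let $\mathcal{V}^c$ be a set of trace variables that are free in $\varphi$. Let $\Pi'_{\mathbb{T}}$ be any trace assignment over the trace variables in $\mathcal{V}^c_{\mathcal{X}}\cup\mathrm{free}(\varphi)$ such that $\Pi_{\mathbb{T}}(\pi)=_{\{x\}}\Pi'_{\mathbb{T}}(\pi_x)$ for all $\pi\in\mathcal{V}^c$ and $x\in\mathcal{X}$, and $\Pi'_{\mathbb{T}}(\pi)=\Pi_{\mathbb{T}}(\pi)$ for all trace variables $\pi\notin\mathcal{V}^c$. Then $(T,(\Pi_{\mathbb{T}},\Pi_{\mathbb{N}}))\models\varphi$ if and only if $(T,(\Pi'_{\mathbb{T}},\Pi_{\mathbb{N}}))\models\mathtt{flatten}(\varphi,\mathcal{X},\mathcal{V}^c)$.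
   Context: Fix a finite set $\mathcal{X}$ of propositional variables. A valuation is a subset of $\mathcal{X}$; a trace is an infinite sequence $\tau=v_0v_1\dots$ of valuations; $(2^{\mathcal{X}})^\omega$ is the set of all traces and $\tau[k]=v_k$. For $\mathcal{Y}\subseteq\mathcal{X}$, $\tau=_{\mathcal{Y}}\tau'$ means $\tau[k]\cap\mathcal{Y}=\tau'[k]\cap\mathcal{Y}$ for all $k$. Hypertrace formulas are built over a set $\mathcal{V}_{\mathbb{T}}$ of trace variables and a disjoint set $\mathcal{V}_{\mathbb{N}}$ of time variables by the grammar $\varphi ::= \exists\pi\,\varphi \mid \exists^{T}\pi\,\varphi \mid \exists i\,\varphi \mid \neg\varphi \mid \varphi\vee\varphi \mid i<j \mid i=j \mid x(\pi,i)$ with $\pi\in\mathcal{V}_{\mathbb{T}}$, $i,j\in\mathcal{V}_{\mathbb{N}}$, $x\in\mathcal{X}$ (a binary predicate). $\exists\pi$ is an unconstrained trace quantifier, $\exists^T\pi$ a constrained trace quantifier, $\exists i$ a time quantifier; $\forall$, $\forall^T$, $\wedge,\to,\leftrightarrow$ are the usual abbreviations ($\forall^T\pi\,\varphi=\neg\exists^T\pi\,\neg\varphi$). Every variable is quantified at most once. Semantics: for $T\subseteq(2^{\mathcal{X}})^\omega$, a trace assignment $\Pi_{\mathbb{T}}$ (trace variables to traces) and a time assignment $\Pi_{\mathbb{N}}$ (time variables to $\mathbb{N}$): $(T,(\Pi_{\mathbb{T}},\Pi_{\mathbb{N}}))\models\exists\pi\,\varphi$ iff for some $\tau\in(2^{\mathcal{X}})^\omega$,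 $(T,(\Pi_{\mathbb{T}}[\pi\mapsto\tau],\Pi_{\mathbb{N}}))\models\varphi$; $\exists^T\pi\,\varphi$ is the same but with $\tau\in T$; $\exists i\,\varphi$ iff for some $k\in\mathbb{N}$, $(T,(\Pi_{\mathbb{T}},\Pi_{\mathbb{N}}[i\mapsto k]))\models\varphi$; Boolean connectives as usual; $i<j$, $i=j$ compare $\Pi_{\mathbb{N}}(i),\Pi_{\mathbb{N}}(j)$ in $\mathbb{N}$; $x(\pi,i)$ holds iff $x\in\Pi_{\mathbb{T}}(\pi)[\Pi_{\mathbb{N}}(i)]$. For a set $\mathcal{V}$ of trace variables, $\mathcal{V}_{\mathcal{X}}=\{\pi_x\mid\pi\in\mathcal{V},x\in\mathcal{X}\}$, where the $\pi_x$ are fresh trace variables. The function $\mathtt{flatten}$ is defined by: $\mathtt{flatten}(\exists\pi\,\varphi,\{x_0,\dots,x_n\},\mathcal{V}^c)=\exists\pi_{x_0}\cdots\exists\pi_{x_n}\,\mathtt{flatten}(\varphi,\{x_0,\dots,x_n\},\mathcal{V}^c\cup\{\pi\})$; $\mathtt{flatten}(\exists^T\pi\,\varphi,\mathcal{X},\mathcal{V}^c)=\exists^T\pi\,\mathtt{flatten}(\varphi,\mathcal{X},\mathcal{V}^c)$; $\mathtt{flatten}(\exists i\,\varphi,\mathcal{X},\mathcal{V}^c)=\exists i\,\mathtt{flatten}(\varphi,\mathcal{X},\mathcal{V}^c)$; $\mathtt{flatten}(x(\pi,i),\mathcal{X},\mathcal{V}^c)$ is $x(\pi_x,i)$ if $\pi\in\mathcal{V}^c$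 and $x(\pi,i)$ otherwise; atoms $i<j$, $i=j$ are unchanged; $\mathtt{flatten}$ commutes with $\neg$ and $\vee$. -}

module Defs where

open import Data.Nat using (ℕ; _<_)
import Data.Nat as N
open import Data.Fin using (Fin)
import Data.Fin as Fin
open import Data.Bool using (Bool; true; false; if_then_else_; _∨_)
open import Data.List using (List; []; _∷_; _++_; foldr; allFin)
open import Data.List.Membership.Propositional using (_∈_; _∉_)
open import Data.List.Relation.Unary.Unique.Propositional using (Unique)
open import Data.Product using (Σ; _×_; _,_)
open import Data.Sum using (_⊎_)
open import Relation.Nullary using (¬_; yes; no)
open import Relation.Binary.PropositionalEquality using (_≡_; refl; cong; cong₂)
open import Relation.Binary.Definitions using (DecidableEquality)

-- Propositional variables 𝒳 = {x₀,…,xₙ} are Fin (suc n).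
-- A valuation is a subset of 𝒳, given by its characteristic function.
Valuation : ℕ → Set
Valuation n = Fin (N.suc n) → Bool


Trace : ℕ → Set
Trace n = ℕ → Valuation n

_=[_]_ : {n : ℕ} → Trace n → Fin (N.suc n) → Trace n → Set
τ =[ x ] τ' = ∀ k → τ k x ≡ τ' k x

data Form (n : ℕ) (V : Set) : Set where
  ∃u   : V → Form n V → Form n V
  ∃T   : V → Form n V → Form n V
  ∃t   : ℕ → Form n V → Form n V
  ¬f   : Form n V → Form n V
  _∨f_ : Form n V → Form n V → Form n V
  _<f_ : ℕ → ℕ → Form n V
  _=f_ : ℕ → ℕ → Form n V
  atom : Fin (N.suc n) → V → ℕ → Form n V

upd : {A B : Set} → DecidableEquality A → (A → B) → A → B → (A → B)
upd _≟_ f a b a' with a' ≟ a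
... | yes _ = b
... | no  _ = f a'

Sat : {n : ℕ} {V : Set} → DecidableEquality V →
      (Trace n → Set) → (V → Trace n) → (ℕ → ℕ) → Form n V → Set
Sat d T Π Πn (∃u π φ) = Σ (Trace _) λ τ → Sat d T (upd d Π π τ) Πn φ
Sat d T Π Πn (∃T π φ) = Σ (Trace _) λ τ → T τ × Sat d T (upd d Π π τ) Πn φ
Sat d T Π Πn (∃t i φ) = Σ ℕ λ k → Sat d T Π (upd N._≟_ Πn i k) φ
Sat d T Π Πn (¬f φ)   = ¬ Sat d T Π Πn φ
Sat d T Π Πn (φ ∨f ψ) = Sat d T Π Πn φ ⊎ Sat d T Π Πn ψ
Sat d T Π Πn (i <f j) = Πn i < Πn j
Sat d T Π Πn (i =f j) = Πn i ≡ Πn j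
Sat d T Π Πn (atom x π i) = Π π (Πn i) x ≡ true

-- Trace variables of flattened formulas: the original ones (named by ℕ)
-- together with the fresh variables π_x.
data FVar (n : ℕ) : Set where
  orig : ℕ → FVar n
  copy : ℕ → Fin (N.suc n) → FVar n

orig-inj : {n a b : ℕ} → orig {n} a ≡ orig b → a ≡ b
orig-inj refl = refl

copy-inj₁ : {n a b : ℕ} {x y : Fin (N.suc n)} → copy a x ≡ copy b y → a ≡ b
copy-inj₁ refl = refl

copy-inj₂ : {n a b : ℕ} {x y : Fin (N.suc n)} → copy a x ≡ copy b y → x ≡ y
copy-inj₂ refl = refl

_≟FV_ : {n : ℕ} → DecidableEquality (FVar n)
orig a ≟FV orig b with a N.≟ b
... | yes p = yes (cong orig p)
... | no ¬p = no λ e → ¬p (orig-inj e)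
orig a ≟FV copy b y = no λ ()
copy a x ≟FV orig b = no λ ()
copy a x ≟FV copy b y with a N.≟ b | x Fin.≟ y
... | yes p | yes q = yes (cong₂ copy p q)
... | no ¬p | _     = no λ e → ¬p (copy-inj₁ e)
... | yes _ | no ¬q = no λ e → ¬q (copy-inj₂ e)

TVSet : Set
TVSet = ℕ → Bool

insert : TVSet → ℕ → TVSet
insert Vc π ρ = Vc ρ ∨ (ρ N.≡ᵇ π)

existsCopies : {n : ℕ} → ℕ → List (Fin (N.suc n)) → Form n (FVar n) → Form n (FVar n)
existsCopies π xs ψ = foldr (λ x ψ' → ∃u (copy π x) ψ') ψ xs

flatten : {n : ℕ} → Form n ℕ → TVSet → Form n (FVar n)
flatten {n} (∃u π φ) Vc = existsCopies π (allFin (N.suc n)) (flatten φ (insert Vc π))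
flatten (∃T π φ) Vc = ∃T (orig π) (flatten φ Vc)
flatten (∃t i φ) Vc = ∃t i (flatten φ Vc)
flatten (¬f φ)   Vc = ¬f (flatten φ Vc)
flatten (φ ∨f ψ) Vc = flatten φ Vc ∨f flatten ψ Vc
flatten (i <f j) Vc = i <f j
flatten (i =f j) Vc = i =f j
flatten (atom x π i) Vc = if Vc π then atom x (copy π x) i else atom x (orig π) i

-- Bound trace / time variables (with multiplicity, one entry per quantifier).
boundT : {n : ℕ} {V : Set} → Form n V → List V
boundT (∃u π φ) = π ∷ boundT φ
boundT (∃T π φ) = π ∷ boundT φ
boundT (∃t i φ) = boundT φ
boundT (¬f φ)   = boundT φ
boundT (φ ∨f ψ) = boundT φ ++ boundT ψ
boundT (i <f j) = []
boundT (i =f j) = []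
boundT (atom x π i) = []

boundN : {n : ℕ} {V : Set} → Form n V → List ℕ
boundN (∃u π φ) = boundN φ
boundN (∃T π φ) = boundN φ
boundN (∃t i φ) = i ∷ boundN φ
boundN (¬f φ)   = boundN φ
boundN (φ ∨f ψ) = boundN φ ++ boundN ψ
boundN (i <f j) = []
boundN (i =f j) = []
boundN (atom x π i) = []

data FreeT {n : ℕ} {V : Set} (π : V) : Form n V → Set where
  f∃u  : ∀ {ρ φ} → ¬ (π ≡ ρ) → FreeT π φ → FreeT π (∃u ρ φ)
  f∃T  : ∀ {ρ φ} → ¬ (π ≡ ρ) → FreeT π φ → FreeT π (∃T ρ φ)
  f∃t  : ∀ {i φ} → FreeT π φ → FreeT π (∃t i φ)
  f¬   : ∀ {φ} → FreeT π φ → FreeT π (¬f φ)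
  f∨ˡ  : ∀ {φ ψ} → FreeT π φ → FreeT π (φ ∨f ψ)
  f∨ʳ  : ∀ {φ ψ} → FreeT π ψ → FreeT π (φ ∨f ψ)
  fatom : ∀ {x i} → FreeT π (atom x π i)

data FreeN {n : ℕ} {V : Set} (i : ℕ) : Form n V → Set where
  f∃u  : ∀ {ρ φ} → FreeN i φ → FreeN i (∃u ρ φ)
  f∃T  : ∀ {ρ φ} → FreeN i φ → FreeN i (∃T ρ φ)
  f∃t  : ∀ {j φ} → ¬ (i ≡ j) → FreeN i φ → FreeN i (∃t j φ)
  f¬   : ∀ {φ} → FreeN i φ → FreeN i (¬f φ)
  f∨ˡ  : ∀ {φ ψ} → FreeN i φ → FreeN i (φ ∨f ψ)
  f∨ʳ  : ∀ {φ ψ} → FreeN i ψ → FreeN i (φ ∨f ψ)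
  f<ˡ  : ∀ {j} → FreeN i (i <f j)
  f<ʳ  : ∀ {j} → FreeN i (j <f i)
  f=ˡ  : ∀ {j} → FreeN i (i =f j)
  f=ʳ  : ∀ {j} → FreeN i (j =f i)
  fatom : ∀ {x π} → FreeN i (atom x π i)

-- Standing convention: every variable is quantified at most once, and
-- (names being distinct) no free variable is also quantified.
WellNamed : {n : ℕ} {V : Set} → Form n V → Set
WellNamed φ = Unique (boundT φ) × Unique (boundN φ)
            × (∀ π → FreeT π φ → π ∉ boundT φ)
            × (∀ i → FreeN i φ → i ∉ boundN φ)

{-# OPTIONS --safe #-}
module Submission where

-- Induction on φ, generalised over V^c and over any pair of assignments related by
-- Splits: each trace of a V^c-variable π is recorded, proposition by proposition, in
-- the copies π_x, and every other trace is kept as it is. A witness τ for ∃π yields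
-- the witnesses π_x := τ for ∃π_{x₀}⋯∃π_{xₙ}; conversely, witnesses for the copies
-- recombine into the trace whose x-component is that of π_x. Well-namedness ensures
-- that no constrained quantifier rebinds a variable of V^c, whose occurrences flatten
-- has already redirected to the copies.

open import Defs
open import Data.Nat using (ℕ; suc; _≟_)
open import Data.Nat.Properties using (≡ᵇ⇒≡; ≡⇒≡ᵇ)
open import Data.Fin using (Fin)
open import Data.Bool using (true; false; _∨_)
open import Data.Bool.Properties using (∨-zeroʳ; ∨-identityʳ; ¬-not; T-≡)
open import Data.Product using (Σ; _×_; _,_)
open import Data.Product.Function.Dependent.Propositional using (Σ-⇔)
open import Data.Product.Function.NonDependent.Propositional using (_×-⇔_)
open import Data.Sum.Function.Propositional using (_⊎-⇔_)
open import Data.List using (List; []; _∷_; _++_; allFin)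
open import Data.List.Relation.Unary.All.Properties using (All¬⇒¬Any; ++⁻ˡ)
open import Data.List.Relation.Unary.Any using (here; there)
open import Data.List.Relation.Unary.AllPairs using ([]; _∷_)
open import Data.List.Relation.Unary.Unique.Propositional using (Unique)
open import Data.List.Membership.Propositional using (_∈_; _∉_)
open import Data.List.Membership.Propositional.Properties using (∈-++⁺ˡ; ∈-++⁺ʳ; ∈-allFin)
open import Relation.Nullary using (yes; no; contradiction)
open import Relation.Binary.Definitions using (DecidableEquality)
open import Relation.Binary.PropositionalEquality using (_≡_; _≢_; refl; sym; trans; cong; subst)
open import Function.Base using (_∘_)
open import Function.Bundles using (_⇔_; mk⇔; Equivalence)
open import Function.Construct.Identity using (↠-id; ⇔-id)
open import Function.Related.TypeIsomorphisms using (¬-cong-⇔)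

Unique-++⁻ˡ : {A : Set} (xs : List A) {ys : List A} → Unique (xs ++ ys) → Unique xs
Unique-++⁻ˡ []       _        = []
Unique-++⁻ˡ (x ∷ xs) (x∉ ∷ u) = ++⁻ˡ xs x∉ ∷ Unique-++⁻ˡ xs u

Unique-++⁻ʳ : {A : Set} (xs : List A) {ys : List A} → Unique (xs ++ ys) → Unique ys
Unique-++⁻ʳ []       u       = u
Unique-++⁻ʳ (x ∷ xs) (_ ∷ u) = Unique-++⁻ʳ xs u

module _ {A B : Set} (_≟A_ : DecidableEquality A) (f : A → B) (a : A) (b : B) where

  upd-≡ : upd _≟A_ f a b a ≡ b
  upd-≡ with a ≟A a
  ... | yes _  = refl
  ... | no a≢a = contradiction refl a≢a

  upd-≢ : ∀ {a'} → a' ≢ a → upd _≟A_ f a b a' ≡ f a'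
  upd-≢ {a'} a'≢a with a' ≟A a
  ... | yes a'≡a = contradiction a'≡a a'≢a
  ... | no _     = refl

insert-self : ∀ Vc π → insert Vc π π ≡ true
insert-self Vc π = trans (cong (Vc π ∨_) (Equivalence.to T-≡ (≡⇒≡ᵇ π π refl))) (∨-zeroʳ (Vc π))

insert-other : ∀ Vc {π ρ} → ρ ≢ π → insert Vc π ρ ≡ Vc ρ
insert-other Vc {π} {ρ} ρ≢π =
  trans (cong (Vc ρ ∨_) (¬-not (λ e → ρ≢π (≡ᵇ⇒≡ ρ π (Equivalence.from T-≡ e)))))
        (∨-identityʳ (Vc ρ))

≡true-⇔ : ∀ {b b'} → b ≡ b' → (b ≡ true) ⇔ (b' ≡ true)
≡true-⇔ b≡b' = mk⇔ (trans (sym b≡b')) (trans b≡b')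

≡⇒=[] : ∀ {n} {τ τ' : Trace n} {x} → τ ≡ τ' → τ =[ x ] τ'
≡⇒=[] refl _ = refl

module _ {n : ℕ} where

  AgreeOffCopies : ℕ → (FVar n → Trace n) → (FVar n → Trace n) → Set
  AgreeOffCopies π Π Π' = ∀ v → (∀ x → v ≢ copy π x) → Π v ≡ Π' v

  upd-copy-agreeOffCopies : ∀ π x τ Π → AgreeOffCopies π (upd _≟FV_ Π (copy π x) τ) Π
  upd-copy-agreeOffCopies π x τ Π v v≢copy = upd-≢ _≟FV_ Π (copy π x) τ (v≢copy x)

  setCopies : ℕ → Trace n → List (Fin (suc n)) → (FVar n → Trace n) → (FVar n → Trace n)
  setCopies π τ []       Π = Π
  setCopies π τ (x ∷ xs) Π = setCopies π τ xs (upd _≟FV_ Π (copy π x) τ)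

  setCopies-stable : ∀ π τ xs Π v → Π v ≡ τ → setCopies π τ xs Π v ≡ τ
  setCopies-stable π τ []       Π v Πv≡τ = Πv≡τ
  setCopies-stable π τ (x ∷ xs) Π v Πv≡τ = setCopies-stable π τ xs _ v updated
    where
    updated : upd _≟FV_ Π (copy π x) τ v ≡ τ
    updated with v ≟FV copy π x
    ... | yes _ = refl
    ... | no  _ = Πv≡τ

  setCopies-∈ : ∀ π τ xs Π {x} → x ∈ xs → setCopies π τ xs Π (copy π x) ≡ τ
  setCopies-∈ π τ (x ∷ xs) Π (here refl) =
    setCopies-stable π τ xs _ (copy π x) (upd-≡ _≟FV_ Π (copy π x) τ)
  setCopies-∈ π τ (y ∷ xs) Π (there x∈xs) = setCopies-∈ π τ xs _ x∈xs

  setCopies-agreeOffCopies : ∀ π τ xs Π → AgreeOffCopies π (setCopies π τ xs Π) Π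
  setCopies-agreeOffCopies π τ []       Π v _        = refl
  setCopies-agreeOffCopies π τ (x ∷ xs) Π v v≢copy =
    trans (setCopies-agreeOffCopies π τ xs _ v v≢copy) (upd-copy-agreeOffCopies π x τ Π v v≢copy)

  module _ (T : Trace n → Set) (ΠN : ℕ → ℕ) (π : ℕ) (ψ : Form n (FVar n)) where

    existsCopies-intro : ∀ τ xs Π → Sat _≟FV_ T (setCopies π τ xs Π) ΠN ψ →
                         Sat _≟FV_ T Π ΠN (existsCopies π xs ψ)
    existsCopies-intro τ []       Π sat = sat
    existsCopies-intro τ (x ∷ xs) Π sat = τ , existsCopies-intro τ xs _ sat

    existsCopies-elim : ∀ xs Π → Sat _≟FV_ T Π ΠN (existsCopies π xs ψ) →
                        Σ (FVar n → Trace n) λ Π' → Sat _≟FV_ T Π' ΠN ψ × AgreeOffCopies π Π' Π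
    existsCopies-elim []       Π sat       = Π , sat , λ _ _ → refl
    existsCopies-elim (x ∷ xs) Π (τ , sat) with existsCopies-elim xs _ sat
    ... | Π' , sat' , agree =
      Π' , sat' , λ v v≢copy → trans (agree v v≢copy) (upd-copy-agreeOffCopies π x τ Π v v≢copy)

record Splits {n : ℕ} (Vc : TVSet) (Π : ℕ → Trace n) (Π' : FVar n → Trace n) : Set where
  field
    copies : ∀ π → Vc π ≡ true → (x : Fin (suc n)) → Π π =[ x ] Π' (copy π x)
    origs  : ∀ π → Vc π ≡ false → Π' (orig π) ≡ Π π

module _ {n : ℕ} {Vc : TVSet} {Π : ℕ → Trace n} {Π' : FVar n → Trace n}
         (split : Splits Vc Π Π') (π : ℕ) (τ : Trace n) where
  open Splits split

  splits-upd-orig : Vc π ≡ false → Splits Vc (upd _≟_ Π π τ) (upd _≟FV_ Π' (orig π) τ)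
  splits-upd-orig Vcπ = record { copies = copies' ; origs = origs' }
    where
    copies' : ∀ ρ → Vc ρ ≡ true → (x : Fin (suc n)) → upd _≟_ Π π τ ρ =[ x ] Π' (copy ρ x)
    copies' ρ Vcρ with ρ ≟ π
    ... | yes refl = contradiction (trans (sym Vcρ) Vcπ) λ ()
    ... | no _     = copies ρ Vcρ

    origs' : ∀ ρ → Vc ρ ≡ false → upd _≟FV_ Π' (orig π) τ (orig ρ) ≡ upd _≟_ Π π τ ρ
    origs' ρ Vcρ with ρ ≟ π
    ... | yes refl = refl
    ... | no _     = origs ρ Vcρ

  splits-upd-insert : ∀ {Π''} → AgreeOffCopies π Π'' Π' → (∀ x → τ =[ x ] Π'' (copy π x)) →
                      Splits (insert Vc π) (upd _≟_ Π π τ) Π''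
  splits-upd-insert {Π''} agree τ-copies = record { copies = copies' ; origs = origs' }
    where
    copies' : ∀ ρ → insert Vc π ρ ≡ true → (x : Fin (suc n)) → upd _≟_ Π π τ ρ =[ x ] Π'' (copy ρ x)
    copies' ρ e x with ρ ≟ π
    ... | yes refl = τ-copies x
    ... | no ρ≢π   = subst (Π ρ =[ x ]_) (sym (agree (copy ρ x) λ _ eq → ρ≢π (copy-inj₁ eq)))
                           (copies ρ (trans (sym (insert-other Vc ρ≢π)) e) x)

    origs' : ∀ ρ → insert Vc π ρ ≡ false → Π'' (orig ρ) ≡ upd _≟_ Π π τ ρ
    origs' ρ e with ρ ≟ π
    ... | yes refl = contradiction (trans (sym (insert-self Vc π)) e) λ ()
    ... | no ρ≢π   = trans (agree (orig ρ) λ _ ()) (origs ρ (trans (sym (insert-other Vc ρ≢π)) e))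

module _ {n : ℕ} (T : Trace n → Set) where

  NotBoundIn : TVSet → Form n ℕ → Set
  NotBoundIn Vc φ = ∀ π → Vc π ≡ true → π ∉ boundT φ

  sat-flatten : ∀ (φ : Form n ℕ) Vc {Π Π'} ΠN → Unique (boundT φ) → NotBoundIn Vc φ →
                Splits Vc Π Π' → Sat _≟_ T Π ΠN φ ⇔ Sat _≟FV_ T Π' ΠN (flatten φ Vc)
  sat-flatten (∃u π φ) Vc {Π} {Π'} ΠN (π∉φ ∷ unique) notBound split = mk⇔ to from
    where
    notBound' : NotBoundIn (insert Vc π) φ
    notBound' ρ e with ρ ≟ π
    ... | yes refl = All¬⇒¬Any π∉φ
    ... | no ρ≢π   = notBound ρ (trans (sym (insert-other Vc ρ≢π)) e) ∘ there

    IH : ∀ τ {Π''} → AgreeOffCopies π Π'' Π' → (∀ x → τ =[ x ] Π'' (copy π x)) →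
         Sat _≟_ T (upd _≟_ Π π τ) ΠN φ ⇔ Sat _≟FV_ T Π'' ΠN (flatten φ (insert Vc π))
    IH τ agree τ-copies =
      sat-flatten φ (insert Vc π) ΠN unique notBound' (splits-upd-insert split π τ agree τ-copies)

    𝒳 : List (Fin (suc n))
    𝒳 = allFin (suc n)

    to : Sat _≟_ T Π ΠN (∃u π φ) → Sat _≟FV_ T Π' ΠN (flatten (∃u π φ) Vc)
    to (τ , sat) = existsCopies-intro T ΠN π _ τ 𝒳 Π' (Equivalence.to (IH τ agree τ-copies) sat)
      where
      agree : AgreeOffCopies π (setCopies π τ 𝒳 Π') Π'
      agree = setCopies-agreeOffCopies π τ 𝒳 Π'

      τ-copies : ∀ x → τ =[ x ] setCopies π τ 𝒳 Π' (copy π x)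
      τ-copies x = ≡⇒=[] (sym (setCopies-∈ π τ 𝒳 Π' (∈-allFin x)))

    from : Sat _≟FV_ T Π' ΠN (flatten (∃u π φ) Vc) → Sat _≟_ T Π ΠN (∃u π φ)
    from sat with existsCopies-elim T ΠN π _ 𝒳 Π' sat
    ... | Π'' , sat'' , agree = τ , Equivalence.from (IH τ agree λ _ _ → refl) sat''
      where
      τ : Trace n
      τ k x = Π'' (copy π x) k x
  sat-flatten (∃T π φ) Vc ΠN (_ ∷ unique) notBound split =
    Σ-⇔ (↠-id _) (⇔-id _ ×-⇔ sat-flatten φ Vc ΠN unique (λ ρ e → notBound ρ e ∘ there)
                                     (splits-upd-orig split π _ Vcπ))
    where
    Vcπ : Vc π ≡ false
    Vcπ = ¬-not λ e → notBound π e (here refl)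
  sat-flatten (∃t i φ) Vc ΠN unique notBound split =
    Σ-⇔ (↠-id _) (sat-flatten φ Vc _ unique notBound split)
  sat-flatten (¬f φ) Vc ΠN unique notBound split =
    ¬-cong-⇔ (sat-flatten φ Vc ΠN unique notBound split)
  sat-flatten (φ ∨f ψ) Vc ΠN unique notBound split =
    sat-flatten φ Vc ΠN (Unique-++⁻ˡ (boundT φ) unique) (λ ρ e → notBound ρ e ∘ ∈-++⁺ˡ) split
    ⊎-⇔ sat-flatten ψ Vc ΠN (Unique-++⁻ʳ (boundT φ) unique) (λ ρ e → notBound ρ e ∘ ∈-++⁺ʳ _) split
  sat-flatten (i <f j) Vc ΠN _ _ _ = ⇔-id _
  sat-flatten (i =f j) Vc ΠN _ _ _ = ⇔-id _
  sat-flatten (atom x π i) Vc ΠN _ _ split with Vc π in Vcπ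
  ... | true  = ≡true-⇔ (Splits.copies split π Vcπ x (ΠN i))
  ... | false = ≡true-⇔ (cong (λ τ → τ (ΠN i) x) (sym (Splits.origs split π Vcπ)))

lemma1 : (n : ℕ) (φ : Form n ℕ) → WellNamed φ →
    (T : Trace n → Set) (ΠT : ℕ → Trace n) (ΠN : ℕ → ℕ) →
    (Vc : TVSet) → (∀ π → Vc π ≡ true → FreeT π φ) →
    (ΠT' : FVar n → Trace n) →
    (∀ π → Vc π ≡ true → (x : Fin (suc n)) → ΠT π =[ x ] ΠT' (copy π x)) →
    (∀ π → Vc π ≡ false → ΠT' (orig π) ≡ ΠT π) →
    Sat _≟_ T ΠT ΠN φ ⇔ Sat _≟FV_ T ΠT' ΠN (flatten φ Vc)
lemma1 n φ (unique , _ , freeNotBound , _) T ΠT ΠN Vc VcFree ΠT' copies origs =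
  sat-flatten T φ Vc ΠN unique (λ π e → freeNotBound π (VcFree π e))
              record { copies = copies ; origs = origs }
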